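{- Let $G=K_{3,7}$. Then $G$ is $(3,1/10)$-flexible and $\chi_{flex}(G)>3$.
   Context: A list assignment $L$ for $G$ assigns to each vertex $v$ a set $L(v)$ of colors; it is a $k$-assignment if $|L(v)|=k$ for all $v$. A proper $L$-coloring is a function $f$ on $V(G)$ with $f(v)\in L(v)$ for all $v$ and $f(u)\neq f(v)$ whenever $uv\in E(G)$. A request of $L$ is a function $r$ with non-empty domain $D\subseteq V(G)$ such that $r(v)\in L(v)$ for each $v\in D$. For $\epsilon\in(0,1]$, $(G,L,r)$ is $\epsilon$-satisfiable if there is a proper $L$-coloring $f$ with $f(v)=r(v)$ for at least $\epsilon|D|$ vertices $v\in D$. $G$ is $(k,\epsilon)$-flexible if $(G,L,r)$ is $\epsilon$-satisfiable for every $k$-assignment $L$ and every request $r$ of $L$. The Hall ratio is $\rho(G)=\max_H |V(H)|/\alpha(H)$ over nonempty subgraphs $H$ of $G$. The list flexibility number $\chi_{flex}(G)$ is the smallest $k$ such that $G$ is $(k,1/\rho(G))$-flexible. -}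

module Defs where

open import Data.Nat using (ℕ; _*_; _≤_; _<_)
open import Data.Bool using (Bool; T; true; false)
open import Data.Fin using (Fin; toℕ)
open import Data.Fin.Subset as Sub using (Subset; ∣_∣; _∩_; Nonempty; _⊆_)
open import Data.List using (List; length)
open import Data.List.Membership.Propositional as LM using ()
open import Data.List.Relation.Unary.Unique.Propositional using (Unique)
open import Data.Vec using (tabulate)
open import Data.Product using (Σ; _×_; ∃)
open import Data.Sum using (_⊎_)
open import Relation.Nullary using (¬_; does)
open import Relation.Binary.PropositionalEquality using (_≡_; _≢_)
import Data.Nat as N

record Graph (n : ℕ) : Set₁ where
  field
    Adj    : Fin n → Fin n → Set
    sym    : ∀ {u v} → Adj u v → Adj v u
    irrefl : ∀ {v} → ¬ Adj v v
open Graph public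

K37-Adj : Fin 10 → Fin 10 → Set
K37-Adj u v = (toℕ u < 3 × 3 ≤ toℕ v) ⊎ (3 ≤ toℕ u × toℕ v < 3)

K37 : Graph 10
K37 = record
  { Adj = K37-Adj
  ; sym = λ { (Data.Sum.inj₁ (a , b)) → Data.Sum.inj₂ (b , a)
            ; (Data.Sum.inj₂ (a , b)) → Data.Sum.inj₁ (b , a) }
  ; irrefl = irr }
  where
  open Data.Product using (_,_)
  open import Data.Nat.Properties using (<⇒≱)
  irr : ∀ {v} → ¬ K37-Adj v v
  irr (Data.Sum.inj₁ (a , b)) = <⇒≱ a b
  irr (Data.Sum.inj₂ (a , b)) = <⇒≱ b a

ListAssignment : ℕ → Set
ListAssignment n = Fin n → List ℕ

IsKAssignment : ∀ {n} → ℕ → ListAssignment n → Set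
IsKAssignment k L = ∀ v → length (L v) ≡ k × Unique (L v)

record Request {n : ℕ} (L : ListAssignment n) : Set where
  field
    dom      : Subset n
    nonempty : Nonempty dom
    req      : Fin n → ℕ
    inList   : ∀ v → v Sub.∈ dom → req v LM.∈ L v
open Request public

ProperLColoring : ∀ {n} → Graph n → ListAssignment n → (Fin n → ℕ) → Set
ProperLColoring G L f = (∀ v → f v LM.∈ L v) × (∀ u v → Adj G u v → f u ≢ f v)

agree : ∀ {n} → (Fin n → ℕ) → (Fin n → ℕ) → Subset n
agree f r = tabulate (λ v → does (f v N.≟ r v))

-- (G,L,r) is ε-satisfiable with ε = num/den:
-- some proper L-colouring f satisfies at least ε|D| requests, i.e. den·#sat ≥ num·|D|.
Satisfiable : ∀ {n} → Graph n → (L : ListAssignment n) → Request L → ℕ → ℕ → Set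
Satisfiable G L r num den =
  ∃ λ f → ProperLColoring G L f × (num * ∣ dom r ∣ ≤ den * ∣ dom r ∩ agree f (req r) ∣)

Flexible : ∀ {n} → Graph n → ℕ → ℕ → ℕ → Set
Flexible G k num den =
  ∀ (L : ListAssignment _) → IsKAssignment k L → (r : Request L) → Satisfiable G L r num den

record Subgraph {n : ℕ} (G : Graph n) : Set where
  field
    verts   : Subset n
    edge    : Fin n → Fin n → Bool
    edgeSym : ∀ u v → T (edge u v) → T (edge v u)
    edgeAdj : ∀ u v → T (edge u v) → Adj G u v
    edgeIn  : ∀ u v → T (edge u v) → u Sub.∈ verts × v Sub.∈ verts
open Subgraph public

IsIndependent : ∀ {n} {G : Graph n} → Subgraph G → Subset n → Set
IsIndependent H I = I ⊆ verts H × (∀ u v → u Sub.∈ I → v Sub.∈ I → ¬ T (edge H u v))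

IsIndepNumber : ∀ {n} {G : Graph n} → Subgraph G → ℕ → Set
IsIndepNumber H a =
  (∃ λ I → IsIndependent H I × ∣ I ∣ ≡ a) × (∀ I → IsIndependent H I → ∣ I ∣ ≤ a)

-- ρ(G) = num/den (den > 0): the maximum of |V(H)|/α(H) over non-empty subgraphs H.
IsHallRatio : ∀ {n} → Graph n → ℕ → ℕ → Set
IsHallRatio G num den =
  (Σ (Subgraph G) λ H → Nonempty (verts H) ×
     ∃ λ a → IsIndepNumber H a × ∣ verts H ∣ * den ≡ num * a)
  × (∀ (H : Subgraph G) → Nonempty (verts H) → ∀ a → IsIndepNumber H a →
       ∣ verts H ∣ * den ≤ num * a)

-- χ_flex(G) > k₀ : no k with 1 ≤ k ≤ k₀ makes G (k, 1/ρ(G))-flexible.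
-- (With ρ(G) = num/den, 1/ρ(G) = den/num.)
ChiFlexGreaterThan : ∀ {n} → Graph n → ℕ → Set
ChiFlexGreaterThan G k₀ =
  ∀ num den → 0 < den → IsHallRatio G num den →
  ∀ k → 1 ≤ k → k ≤ k₀ → ¬ Flexible G k den num

-- A single request in K₃,₇ can always be honoured. Whatever vertex carries it, the three
-- vertices of the small side have at least 3 · 3 = 9 (request on the small side) or
-- 2 · 2 · 2 = 8 (request on the large side, whose colour they must avoid) admissible
-- colourings. A list of three distinct colours on the large side leaves no free colour
-- for at most one of them once the palettes are pairwise disjoint, and for none if two
-- small-side vertices share a colour; as 8 > 7, some colouring of the small side extends.
-- So with 3-lists one of at most 10 requests is always met.
-- Conversely K₃,₇ is bipartite, hence ρ ≤ 2, and explicit assignments show that it is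
-- not 2-choosable and that with 3-lists at most one of three requests on the small side
-- can be met, less than the required 3/ρ.
module Submission where

open import Defs hiding (sym)
import Data.Nat as ℕ
open import Data.Nat using (ℕ; zero; suc; _+_; _*_; _≤_; _<_; _≤?_; z≤n; s≤s; s≤s⁻¹; >-nonZero)
open import Data.Nat.Properties
  using (≤-trans; ≤-refl; ≤-reflexive; ≤-<-trans; <-irrefl; <⇒≱; m≤m+n; n≤1+n; +-suc; +-identityʳ; +-mono-≤;
         *-mono-≤; *-monoʳ-≤; *-identityˡ; *-identityʳ; *-cancelʳ-≤; *-cancelˡ-≤; *-assoc; *-comm; module ≤-Reasoning)
open import Data.Fin using (Fin; zero; suc; toℕ; punchIn; remQuot; fromℕ<; _↑ˡ_; _↑ʳ_; splitAt)
open import Data.Fin.Patterns using (0F; 1F; 2F; 3F; 4F; 5F; 6F; 7F; 8F; 9F)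
open import Data.Fin.Properties
  using (punchIn-punchOut; *↔×; injective⇒≤; toℕ<n; toℕ-↑ˡ; splitAt-↑ˡ)
  renaming (_≟_ to _≟ᶠ_; any? to anyᶠ?; all? to allᶠ?; ¬∀⟶∃¬ to ¬∀⟶∃¬ᶠ)
open import Data.Fin.Subset using (Subset; ∣_∣; _∩_; ∁; ⁅_⁆; inside; outside)
import Data.Fin.Subset as Subset
open import Data.Fin.Subset.Properties using (∣p∣≤n; x∈p∩q⁺; x∈p∩q⁻; x∈p⇒∣p-x∣<∣p∣; ∉⊥; x∈⁅y⁆⇒x≡y; ∣⁅x⁆∣≡1)
import Data.Vec as Vec
open import Data.Vec.Properties using (lookup⇒[]=; lookup∘tabulate)
open import Data.Vec.Functional using (Vector; updateAt)
open import Data.Vec.Functional.Properties using (updateAt-updates; updateAt-minimal)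
open import Data.List using (List; []; _∷_; [_]; length; _++_; lookup; filter; tabulate)
open import Data.List.Properties using (length-++)
open import Data.List.Membership.Propositional using (_∈_; _∉_; find; lose)
open import Data.List.Membership.Propositional.Properties
  using (∈-++⁺ˡ; ∈-++⁺ʳ; ∈-++⁻; ∈-∃++; ∈-lookup; ∈-filter⁺; ∈-filter⁻; ∈-tabulate⁺; ∈-tabulate⁻)
open import Data.List.Relation.Binary.Subset.Propositional using (_⊆_)
open import Data.List.Relation.Binary.Subset.DecPropositional ℕ._≟_ using (_⊆?_)
open import Data.List.Relation.Binary.Disjoint.Propositional using (Disjoint)
open import Data.List.Relation.Unary.Any using (Any; here; there; any?)
open import Data.List.Relation.Unary.All using (All; [])
import Data.List.Relation.Unary.All as All
open import Data.List.Relation.Unary.All.Properties using (¬Any⇒All¬)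
open import Data.List.Relation.Unary.AllPairs using ([]; _∷_)
open import Data.List.Relation.Unary.Unique.Propositional using (Unique)
open import Data.List.Relation.Unary.Unique.Propositional.Properties using (Unique[x∷xs]⇒x∉xs; filter⁺)
open import Data.List.Relation.Unary.Unique.DecPropositional ℕ._≟_ using (unique?)
open import Data.Product using (_×_; ∃; ∃₂; _,_; proj₁; proj₂)
open import Data.Product.Properties using (×-≡,≡→≡)
open import Data.Sum using (_⊎_; inj₁; inj₂; [_,_]′)
open import Function using (_∘_)
open import Function.Bundles using (Injection)
open import Function.Definitions using (Injective)
open import Function.Properties.Inverse using (Inverse⇒Injection)
open import Relation.Binary.Definitions using (DecidableEquality)
open import Relation.Binary.PropositionalEquality using (_≡_; _≢_; _≗_; refl; sym; trans; cong; subst)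
open import Relation.Nullary using (¬_; Dec; does; yes; no; contradiction)
open import Relation.Nullary.Decidable using (¬?; _×-dec_; _⊎-dec_; decidable-stable; dec-true; toWitness)

module _ {A : Set} where

  length-++-∷ : ∀ (us : List A) {y vs} → length (us ++ y ∷ vs) ≡ suc (length (us ++ vs))
  length-++-∷ us {y} {vs} rewrite length-++ us {y ∷ vs} | length-++ us {vs} = +-suc (length us) (length vs)

  ⊆-delete : ∀ {xs : List A} {y} us {vs} → xs ⊆ us ++ y ∷ vs → y ∉ xs → xs ⊆ us ++ vs
  ⊆-delete us sub y∉xs x∈xs with ∈-++⁻ us (sub x∈xs)
  ... | inj₁ x∈us         = ∈-++⁺ˡ x∈us
  ... | inj₂ (here refl)  = contradiction x∈xs y∉xs
  ... | inj₂ (there x∈vs) = ∈-++⁺ʳ us x∈vs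

  Unique-⊆⇒length≤ : ∀ {xs ys : List A} → Unique xs → xs ⊆ ys → length xs ≤ length ys
  Unique-⊆⇒length≤ [] _ = z≤n
  Unique-⊆⇒length≤ {x ∷ xs} u@(_ ∷ u′) sub with ∈-∃++ (sub (here refl))
  ... | us , vs , refl = subst (suc (length xs) ≤_) (sym (length-++-∷ us))
    (s≤s (Unique-⊆⇒length≤ u′ (⊆-delete us (sub ∘ there) (Unique[x∷xs]⇒x∉xs u))))

  lookup-injective : ∀ {xs : List A} → Unique xs → Injective _≡_ _≡_ (lookup xs)
  lookup-injective {x ∷ xs} (x∉xs ∷ u) {zero}  {zero}  _  = refl
  lookup-injective {x ∷ xs} (x∉xs ∷ u) {zero}  {suc j} eq = contradiction eq (All.lookup x∉xs (∈-lookup j))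
  lookup-injective {x ∷ xs} (x∉xs ∷ u) {suc i} {zero}  eq = contradiction (sym eq) (All.lookup x∉xs (∈-lookup i))
  lookup-injective {x ∷ xs} (x∉xs ∷ u) {suc i} {suc j} eq = cong suc (lookup-injective u eq)

module _ {A : Set} (_≟_ : DecidableEquality A) where
  open import Data.List.Membership.DecPropositional _≟_ using (_∈?_)

  Unique-⊆⇒⊇ : ∀ {xs ys : List A} → Unique xs → xs ⊆ ys → length ys ≤ length xs → ys ⊆ xs
  Unique-⊆⇒⊇ {xs} u sub ys≤xs {y} y∈ys with y ∈? xs
  ... | yes y∈xs = y∈xs
  ... | no y∉xs with ∈-∃++ y∈ys
  ...   | us , vs , refl = contradiction
    (≤-trans ys≤xs (Unique-⊆⇒length≤ u (⊆-delete us sub y∉xs)))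
    (subst (λ m → ¬ m ≤ length (us ++ vs)) (sym (length-++-∷ us)) (<-irrefl refl))

  any-∉-or-⊆ : ∀ xs ys → Any (_∉ ys) xs ⊎ xs ⊆ ys
  any-∉-or-⊆ xs ys with any? (λ x → ¬? (x ∈? ys)) xs
  ... | yes some = inj₁ some
  ... | no none  = inj₂ λ {x} x∈xs → decidable-stable (x ∈? ys) (All.lookup (¬Any⇒All¬ xs none) x∈xs)

  length≤suc-length-filter-≢ : ∀ {xs} c → Unique xs → length xs ≤ suc (length (filter (λ x → ¬? (x ≟ c)) xs))
  length≤suc-length-filter-≢ {xs} c u = Unique-⊆⇒length≤ u xs⊆c∷rest
    where
    xs⊆c∷rest : xs ⊆ c ∷ filter (λ x → ¬? (x ≟ c)) xs
    xs⊆c∷rest {x} x∈xs with x ≟ c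
    ... | yes refl = here refl
    ... | no x≢c   = there (∈-filter⁺ (λ x → ¬? (x ≟ c)) x∈xs x≢c)

updateAt⁺ : ∀ {A : Set} {m} (Q : Fin m → A → Set) (xs : Vector A m) i {f : A → A} →
            Q i (f (xs i)) → (∀ j → j ≢ i → Q j (xs j)) → ∀ j → Q j (updateAt xs i f j)
updateAt⁺ Q xs i qᵢ qⱼ j with j ≟ᶠ i
... | yes refl = subst (Q i) (sym (updateAt-updates i xs)) qᵢ
... | no j≢i   = subst (Q j) (sym (updateAt-minimal j i xs j≢i)) (qⱼ j j≢i)

module _ {A : Set} {m} (α : Vector A (suc m)) where

  ∈-tabulate-punchIn : ∀ {k l} → l ≢ k → α l ∈ tabulate (α ∘ punchIn k)
  ∈-tabulate-punchIn {k} l≢k =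
    subst (_∈ tabulate (α ∘ punchIn k)) (cong α (punchIn-punchOut (l≢k ∘ sym))) (∈-tabulate⁺ _)

  tabulate-⊆-punchIn : ∀ {j k} → j ≢ k → α j ≡ α k → tabulate α ⊆ tabulate (α ∘ punchIn k)
  tabulate-⊆-punchIn {j} {k} j≢k αj≡αk x∈ with ∈-tabulate⁻ {f = α} x∈
  ... | l , refl with l ≟ᶠ k
  ...   | yes refl = subst (_∈ tabulate (α ∘ punchIn k)) αj≡αk (∈-tabulate-punchIn j≢k)
  ...   | no l≢k   = ∈-tabulate-punchIn l≢k

remQuot-injective : ∀ {m} n → Injective _≡_ _≡_ (remQuot {m} n)
remQuot-injective {m} n = Injection.injective (Inverse⇒Injection (*↔× {m} {n}))

∏ : Vector ℕ 3 → ℕ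
∏ s = s 0F * s 1F * s 2F

∏-mono-≤ : ∀ {s t} → (∀ j → s j ≤ t j) → ∏ s ≤ ∏ t
∏-mono-≤ s≤t = *-mono-≤ (*-mono-≤ (s≤t 0F) (s≤t 1F)) (s≤t 2F)

-- Choosing colours from palettes

module _ {m} (P : Fin m → List ℕ) where
  open import Data.List.Membership.DecPropositional ℕ._≟_ using (_∈?_)

  Admissible : Vector ℕ m → Set
  Admissible α = ∀ j → α j ∈ P j

  PairwiseDisjoint : Set
  PairwiseDisjoint = ∀ {j k} → j ≢ k → Disjoint (P j) (P k)

  shared-or-disjoint : (∃₂ λ j k → j ≢ k × ∃ λ c → c ∈ P j × c ∈ P k) ⊎ PairwiseDisjoint
  shared-or-disjoint with anyᶠ? (λ j → anyᶠ? (λ k → ¬? (j ≟ᶠ k) ×-dec any? (_∈? P k) (P j)))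
  ... | yes (j , k , j≢k , shared) = let c , c∈j , c∈k = find shared in inj₁ (j , k , j≢k , c , c∈j , c∈k)
  ... | no none = inj₂ λ j≢k (c∈j , c∈k) → none (_ , _ , j≢k , lose c∈j c∈k)

  admissible-with-repeat : ∀ {α j k c} → j ≢ k → c ∈ P j → c ∈ P k → Admissible α →
                           ∃ λ β → Admissible β × β j ≡ β k
  admissible-with-repeat {α} {j} {k} {c} j≢k c∈j c∈k adm =
    β , updateAt⁺ In-P α′ k c∈k (λ l _ → updateAt⁺ In-P α j c∈j (λ l _ → adm l) l) ,
    trans (trans (updateAt-minimal j k α′ j≢k) (updateAt-updates j α)) (sym (updateAt-updates k α′))
    where
    In-P : Fin m → ℕ → Set
    In-P l x = x ∈ P l
    α′ β : Vector ℕ m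
    α′ = updateAt α j (λ _ → c)
    β  = updateAt α′ k (λ _ → c)

  tabulate-⊆⇒≗ : PairwiseDisjoint → ∀ {α β} → Admissible α → Admissible β → tabulate α ⊆ tabulate β → α ≗ β
  tabulate-⊆⇒≗ disjoint {α} {β} adm-α adm-β sub j with ∈-tabulate⁻ {f = β} (sub (∈-tabulate⁺ j))
  ... | l , αj≡βl with j ≟ᶠ l
  ...   | yes refl = αj≡βl
  ...   | no j≢l   = contradiction (adm-α j , subst (_∈ P l) (sym αj≡βl) (adm-β l)) (disjoint j≢l)

module ThreeColourChoice {n} (lists : Fin n → List ℕ) (lists-unique : ∀ w → Unique (lists w))
                         (lists-long : ∀ w → 3 ≤ length (lists w)) where
  open import Data.List.Membership.DecPropositional ℕ._≟_ using (_∈?_)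

  Extendable : Vector ℕ 3 → Set
  Extendable α = ∀ w → Any (_∉ tabulate α) (lists w)

  extendable? : ∀ α → Dec (Extendable α)
  extendable? α = allᶠ? λ w → any? (λ x → ¬? (x ∈? tabulate α)) (lists w)

  covered-if-not-extendable : ∀ {α} → ¬ Extendable α → ∃ λ w → lists w ⊆ tabulate α
  covered-if-not-extendable {α} ¬ext
    with w , ¬free ← ¬∀⟶∃¬ᶠ n _ (λ w → any? (λ x → ¬? (x ∈? tabulate α)) (lists w)) ¬ext
    with any-∉-or-⊆ ℕ._≟_ (lists w) (tabulate α)
  ... | inj₁ free    = contradiction free ¬free
  ... | inj₂ covered = w , covered

  extendable-if-few-colours : ∀ {α ys} → tabulate α ⊆ ys → length ys < 3 → Extendable α
  extendable-if-few-colours {α} {ys} sub short w with any-∉-or-⊆ ℕ._≟_ (lists w) (tabulate α)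
  ... | inj₁ free    = free
  ... | inj₂ covered = contradiction
    (≤-trans (lists-long w) (Unique-⊆⇒length≤ (lists-unique w) (sub ∘ covered))) (<⇒≱ short)

  extendable-if-repeated : ∀ {α j k} → j ≢ k → α j ≡ α k → Extendable α
  extendable-if-repeated {α} {j} {k} j≢k αj≡αk =
    extendable-if-few-colours {α} {tabulate (α ∘ punchIn k)} (tabulate-⊆-punchIn α j≢k αj≡αk) ≤-refl

  module _ (P : Fin 3 → List ℕ) (P-unique : ∀ j → Unique (P j)) where

    private
      s₀ s₁ s₂ : ℕ
      s₀ = length (P 0F)
      s₁ = length (P 1F)
      s₂ = length (P 2F)

    index : Fin (∏ (length ∘ P)) → (j : Fin 3) → Fin (length (P j))
    index k 0F = proj₁ (remQuot {s₀} s₁ (proj₁ (remQuot {s₀ * s₁} s₂ k)))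
    index k 1F = proj₂ (remQuot {s₀} s₁ (proj₁ (remQuot {s₀ * s₁} s₂ k)))
    index k 2F = proj₂ (remQuot {s₀ * s₁} s₂ k)

    index-injective : ∀ {k k′} → (∀ j → index k j ≡ index k′ j) → k ≡ k′
    index-injective eq = remQuot-injective {s₀ * s₁} s₂
      (×-≡,≡→≡ (remQuot-injective {s₀} s₁ (×-≡,≡→≡ (eq 0F , eq 1F)) , eq 2F))

    choice : Fin (∏ (length ∘ P)) → Vector ℕ 3
    choice k j = lookup (P j) (index k j)

    choice-admissible : ∀ k → Admissible P (choice k)
    choice-admissible k j = ∈-lookup (index k j)

    choice-injective : ∀ {k k′} → choice k ≗ choice k′ → k ≡ k′
    choice-injective eq = index-injective λ j → lookup-injective (P-unique j) (eq j)

    -- Against pairwise disjoint palettes a list of three distinct colours covers at most one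
    -- choice, so with more choices than lists some choice is covered by no list.
    extendable-choice : n < ∏ (length ∘ P) → ∃ λ α → Admissible P α × Extendable α
    extendable-choice n<∏ with shared-or-disjoint P
    ... | inj₁ (j , k , j≢k , c , c∈j , c∈k) =
      let α , adm , αj≡αk = admissible-with-repeat P j≢k c∈j c∈k (choice-admissible (fromℕ< (≤-<-trans z≤n n<∏)))
      in  α , adm , extendable-if-repeated {α} j≢k αj≡αk
    ... | inj₂ disjoint with anyᶠ? (extendable? ∘ choice)
    ...   | yes (k , ext) = choice k , choice-admissible k , ext
    ...   | no none       = contradiction (injective⇒≤ killer-injective) (<⇒≱ n<∏)
      where
      killer : Fin (∏ (length ∘ P)) → Fin n
      killer k = proj₁ (covered-if-not-extendable {choice k} (λ ext → none (k , ext)))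

      killed : ∀ k → lists (killer k) ⊆ tabulate (choice k)
      killed k = proj₂ (covered-if-not-extendable {choice k} (λ ext → none (k , ext)))

      killer-injective : ∀ {k k′} → killer k ≡ killer k′ → k ≡ k′
      killer-injective {k} {k′} same = choice-injective
        (tabulate-⊆⇒≗ P disjoint (choice-admissible k) (choice-admissible k′)
          (subst (λ w → lists w ⊆ tabulate (choice k′)) (sym same) (killed k′) ∘
           Unique-⊆⇒⊇ ℕ._≟_ (lists-unique (killer k)) (killed k) (lists-long (killer k))))

left : Fin 3 → Fin 10
left i = i ↑ˡ 7

right : Fin 7 → Fin 10
right w = 3 ↑ʳ w

data Side : Fin 10 → Set where
  inLeft  : ∀ i → Side (left i)
  inRight : ∀ w → Side (right w)

side : ∀ v → Side v
side 0F                   = inLeft 0F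
side 1F                   = inLeft 1F
side 2F                   = inLeft 2F
side (suc (suc (suc w))) = inRight w

toℕ-left<3 : ∀ i → toℕ (left i) < 3
toℕ-left<3 i = subst (_< 3) (sym (toℕ-↑ˡ i 7)) (toℕ<n i)

3≤toℕ-right : ∀ w → 3 ≤ toℕ (right w)
3≤toℕ-right w = m≤m+n 3 (toℕ w)

left-right-adjacent : ∀ i w → Adj K37 (left i) (right w)
left-right-adjacent i w = inj₁ (toℕ-left<3 i , 3≤toℕ-right w)

<3-independent : ∀ {u v} → toℕ u < 3 → toℕ v < 3 → ¬ Adj K37 u v
<3-independent u<3 v<3 (inj₁ (_ , 3≤v)) = <⇒≱ v<3 3≤v
<3-independent u<3 v<3 (inj₂ (3≤u , _)) = <⇒≱ u<3 3≤u

≥3-independent : ∀ {u v} → 3 ≤ toℕ u → 3 ≤ toℕ v → ¬ Adj K37 u v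
≥3-independent 3≤u 3≤v (inj₁ (u<3 , _)) = <⇒≱ u<3 3≤u
≥3-independent 3≤u 3≤v (inj₂ (_ , v<3)) = <⇒≱ v<3 3≤v

proper-if-sides-differ : ∀ {f : Fin 10 → ℕ} → (∀ i w → f (left i) ≢ f (right w)) →
                         ∀ u v → Adj K37 u v → f u ≢ f v
proper-if-sides-differ differ u v adj with side u | side v
... | inLeft i  | inLeft j  = contradiction adj (<3-independent (toℕ-left<3 i) (toℕ-left<3 j))
... | inLeft i  | inRight w = differ i w
... | inRight w | inLeft i  = differ i w ∘ sym
... | inRight w | inRight x = contradiction adj (≥3-independent (3≤toℕ-right w) (3≤toℕ-right x))

glue : ∀ {A : Set} → Vector A 3 → Vector A 7 → Fin 10 → A
glue α β = [ α , β ]′ ∘ splitAt 3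

glue-left : ∀ {A : Set} (α : Vector A 3) β i → glue α β (left i) ≡ α i
glue-left α β i = cong [ α , β ]′ (splitAt-↑ˡ 3 i 7)

Fits : ListAssignment 10 → Vector ℕ 3 → Fin 7 → ℕ → Set
Fits L α w x = x ∈ L (right w) × x ∉ tabulate α

glue-proper : ∀ {L α β} → (∀ i → α i ∈ L (left i)) → (∀ w → Fits L α w (β w)) →
              ProperLColoring K37 L (glue α β)
glue-proper {L} {α} {β} α∈ β-fits = member , proper-if-sides-differ differ
  where
  member : ∀ v → glue α β v ∈ L v
  member v with side v
  ... | inLeft i  = subst (_∈ L (left i)) (sym (glue-left α β i)) (α∈ i)
  ... | inRight w = proj₁ (β-fits w)

  differ : ∀ i w → glue α β (left i) ≢ β w
  differ i w eq = proj₂ (β-fits w)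
    (subst (_∈ tabulate α) (trans (sym (glue-left α β i)) eq) (∈-tabulate⁺ {f = α} i))

agree⁺ : ∀ {n} {f r : Fin n → ℕ} {v} → f v ≡ r v → v Subset.∈ agree f r
agree⁺ {f = f} {r} {v} fv≡rv =
  lookup⇒[]= v _ (trans (lookup∘tabulate (λ u → does (f u ℕ.≟ r u)) v) (dec-true (f v ℕ.≟ r v) fv≡rv))

flexible-if-requests-honoured :
  ∀ {n} (G : Graph n) k →
  (∀ L → IsKAssignment k L → ∀ v c → c ∈ L v → ∃ λ f → ProperLColoring G L f × f v ≡ c) →
  Flexible G k 1 n
flexible-if-requests-honoured {n} G k honour L isK r
  with v , v∈D ← nonempty r
  with f , proper , fv≡rv ← honour L isK v (req r v) (inList r v v∈D) = f , proper , (begin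
    1 * ∣ dom r ∣                     ≡⟨ *-identityˡ _ ⟩
    ∣ dom r ∣                         ≤⟨ ∣p∣≤n (dom r) ⟩
    n                                 ≡⟨ *-identityʳ n ⟨
    n * 1                             ≤⟨ *-monoʳ-≤ n (≤-<-trans z≤n (x∈p⇒∣p-x∣<∣p∣ v∈satisfied)) ⟩
    n * ∣ dom r ∩ agree f (req r) ∣   ∎)
  where
  open ≤-Reasoning
  v∈satisfied : v Subset.∈ dom r ∩ agree f (req r)
  v∈satisfied = x∈p∩q⁺ (v∈D , agree⁺ {f = f} {req r} fv≡rv)

module SingleRequest (L : ListAssignment 10) (isK : IsKAssignment 3 L) where
  open ThreeColourChoice (L ∘ right) (proj₂ ∘ isK ∘ right) (≤-reflexive ∘ sym ∘ proj₁ ∘ isK ∘ right)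

  Honoured : Fin 10 → ℕ → Set
  Honoured v c = ∃ λ f → ProperLColoring K37 L f × f v ≡ c

  fitting : ∀ {α} → Extendable α → ∀ w → ∃ (Fits L α w)
  fitting ext w = let x , x∈ , x∉ = find (ext w) in x , x∈ , x∉

  ∏-singleton : ∀ i c → ∏ (length ∘ updateAt (L ∘ left) i (λ _ → [ c ])) ≡ 9
  ∏-singleton 0F c rewrite proj₁ (isK 1F) | proj₁ (isK 2F) = refl
  ∏-singleton 1F c rewrite proj₁ (isK 0F) | proj₁ (isK 2F) = refl
  ∏-singleton 2F c rewrite proj₁ (isK 0F) | proj₁ (isK 1F) = refl

  honour-left : ∀ i {c} → c ∈ L (left i) → Honoured (left i) c
  honour-left i {c} c∈ =
    let α , α∈P , ext = extendable-choice P P-unique (subst (7 <_) (sym (∏-singleton i c)) (n≤1+n 8))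
        β = proj₁ ∘ fitting {α} ext
    in  glue α β , glue-proper {L} {α} {β} (λ j → P⊆L j (α∈P j)) (proj₂ ∘ fitting {α} ext) ,
        trans (glue-left α β i) (∈P-i⇒≡c (α∈P i))
    where
    P : Fin 3 → List ℕ
    P = updateAt (L ∘ left) i (λ _ → [ c ])

    P-unique : ∀ j → Unique (P j)
    P-unique = updateAt⁺ (λ _ → Unique) (L ∘ left) i ([] ∷ []) (λ j _ → proj₂ (isK (left j)))

    P⊆L : ∀ j → P j ⊆ L (left j)
    P⊆L = updateAt⁺ (λ j xs → xs ⊆ L (left j)) (L ∘ left) i (λ { (here refl) → c∈ }) (λ j _ x∈ → x∈)

    ∈P-i⇒≡c : ∀ {x} → x ∈ P i → x ≡ c
    ∈P-i⇒≡c x∈ with here x≡c ← subst (_ ∈_) (updateAt-updates i (L ∘ left)) x∈ = x≡c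

  honour-right : ∀ w₀ {c} → c ∈ L (right w₀) → Honoured (right w₀) c
  honour-right w₀ {c} c∈ =
    let α , α∈P , ext = extendable-choice P P-unique (∏-mono-≤ 2≤|P|)
        β = updateAt (proj₁ ∘ fitting {α} ext) w₀ (λ _ → c)
    in  glue α β ,
        glue-proper {L} {α} {β} (λ j → proj₁ (∈-filter⁻ avoid-c {xs = L (left j)} (α∈P j)))
          (updateAt⁺ (Fits L α) _ w₀ (c∈ , c∉ α∈P) (λ w _ → proj₂ (fitting {α} ext w))) ,
        updateAt-updates w₀ _
    where
    avoid-c : ∀ x → Dec (x ≢ c)
    avoid-c x = ¬? (x ℕ.≟ c)

    P : Fin 3 → List ℕ
    P j = filter avoid-c (L (left j))

    P-unique : ∀ j → Unique (P j)
    P-unique j = filter⁺ avoid-c (proj₂ (isK (left j)))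

    2≤|P| : ∀ j → 2 ≤ length (P j)
    2≤|P| j = s≤s⁻¹ (subst (_≤ suc (length (P j))) (proj₁ (isK (left j)))
                           (length≤suc-length-filter-≢ ℕ._≟_ c (proj₂ (isK (left j)))))

    c∉ : ∀ {α} → Admissible P α → c ∉ tabulate α
    c∉ {α} α∈P c∈α with j , c≡αj ← ∈-tabulate⁻ {f = α} c∈α =
      proj₂ (∈-filter⁻ avoid-c {xs = L (left j)} (α∈P j)) (sym c≡αj)

  honour : ∀ v {c} → c ∈ L v → Honoured v c
  honour v with side v
  ... | inLeft i  = honour-left i
  ... | inRight w = honour-right w

flexible : Flexible K37 3 1 10
flexible = flexible-if-requests-honoured K37 3 λ L isK v c → SingleRequest.honour L isK v

-- The Hall ratio of a bipartite graph

∣p∣≡∣p∩q∣+∣p∩∁q∣ : ∀ {n} (p q : Subset n) → ∣ p ∣ ≡ ∣ p ∩ q ∣ + ∣ p ∩ ∁ q ∣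
∣p∣≡∣p∩q∣+∣p∩∁q∣ Vec.[]            Vec.[]            = refl
∣p∣≡∣p∩q∣+∣p∩∁q∣ (inside  Vec.∷ p) (inside  Vec.∷ q) = cong suc (∣p∣≡∣p∩q∣+∣p∩∁q∣ p q)
∣p∣≡∣p∩q∣+∣p∩∁q∣ (inside  Vec.∷ p) (outside Vec.∷ q) = trans (cong suc (∣p∣≡∣p∩q∣+∣p∩∁q∣ p q)) (sym (+-suc _ _))
∣p∣≡∣p∩q∣+∣p∩∁q∣ (outside Vec.∷ p) (_       Vec.∷ q) = ∣p∣≡∣p∩q∣+∣p∩∁q∣ p q

module _ {n} {G : Graph n} (H : Subgraph G) where

  independent-∩ : ∀ {S} → (∀ {u v} → u Subset.∈ S → v Subset.∈ S → ¬ Adj G u v) → IsIndependent H (verts H ∩ S)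
  independent-∩ {S} S-indep =
    (λ x∈ → proj₁ (x∈p∩q⁻ (verts H) S x∈)) ,
    λ u v u∈ v∈ e → S-indep (proj₂ (x∈p∩q⁻ (verts H) S u∈)) (proj₂ (x∈p∩q⁻ (verts H) S v∈)) (edgeAdj H u v e)

  independent-⁅x⁆ : ∀ {x} → x Subset.∈ verts H → IsIndependent H ⁅ x ⁆
  independent-⁅x⁆ {x} x∈V =
    (λ y∈ → subst (Subset._∈ verts H) (sym (x∈⁅y⁆⇒x≡y x y∈)) x∈V) ,
    λ u v u∈ v∈ e → irrefl G (subst (Adj G u) (trans (x∈⁅y⁆⇒x≡y x v∈) (sym (x∈⁅y⁆⇒x≡y x u∈))) (edgeAdj H u v e))

module Bipartite {n} (G : Graph n) (S : Subset n)
                 (S-indep  : ∀ {u v} → u Subset.∈ S   → v Subset.∈ S   → ¬ Adj G u v)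
                 (∁S-indep : ∀ {u v} → u Subset.∈ ∁ S → v Subset.∈ ∁ S → ¬ Adj G u v) where

  ∣V∣≤2α : (H : Subgraph G) → ∀ {a} → IsIndepNumber H a → ∣ verts H ∣ ≤ 2 * a
  ∣V∣≤2α H {a} (_ , maximum) = begin
    ∣ verts H ∣                           ≡⟨ ∣p∣≡∣p∩q∣+∣p∩∁q∣ (verts H) S ⟩
    ∣ verts H ∩ S ∣ + ∣ verts H ∩ ∁ S ∣   ≤⟨ +-mono-≤ (maximum _ (independent-∩ H S-indep))
                                                      (maximum _ (independent-∩ H ∁S-indep)) ⟩
    a + a                                 ≡⟨ cong (a +_) (+-identityʳ a) ⟨
    2 * a                                 ∎
    where open ≤-Reasoning

  hallRatio≤2 : ∀ {num den} → IsHallRatio G num den → num ≤ 2 * den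
  hallRatio≤2 {num} {den} ((H , (x , x∈V) , a , α[H]≡a@(_ , maximum) , |V|*den≡num*a) , _) =
    *-cancelʳ-≤ num (2 * den) a {{>-nonZero 0<a}} (begin
      num * a             ≡⟨ |V|*den≡num*a ⟨
      ∣ verts H ∣ * den   ≤⟨ *-mono-≤ (∣V∣≤2α H α[H]≡a) ≤-refl ⟩
      2 * a * den         ≡⟨ *-assoc 2 a den ⟩
      2 * (a * den)       ≡⟨ cong (2 *_) (*-comm a den) ⟩
      2 * (den * a)       ≡⟨ *-assoc 2 den a ⟨
      2 * den * a         ∎)
    where
    open ≤-Reasoning
    0<a : 0 < a
    0<a = subst (_≤ a) (∣⁅x⁆∣≡1 x) (maximum ⁅ x ⁆ (independent-⁅x⁆ H x∈V))

leftSide : Subset 10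
leftSide = inside Vec.∷ inside Vec.∷ inside Vec.∷ Subset.⊥

∈leftSide⇒<3 : ∀ {u} → u Subset.∈ leftSide → toℕ u < 3
∈leftSide⇒<3 {0F} _ = s≤s z≤n
∈leftSide⇒<3 {1F} _ = s≤s (s≤s z≤n)
∈leftSide⇒<3 {2F} _ = s≤s (s≤s (s≤s z≤n))
∈leftSide⇒<3 {suc (suc (suc u))} (Vec.there (Vec.there (Vec.there u∈⊥))) = contradiction u∈⊥ ∉⊥

∈∁leftSide⇒≥3 : ∀ {u} → u Subset.∈ ∁ leftSide → 3 ≤ toℕ u
∈∁leftSide⇒≥3 {0F} ()
∈∁leftSide⇒≥3 {1F} (Vec.there ())
∈∁leftSide⇒≥3 {2F} (Vec.there (Vec.there ()))
∈∁leftSide⇒≥3 {suc (suc (suc u))} _ = s≤s (s≤s (s≤s z≤n))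

K37-hallRatio≤2 : ∀ {num den} → IsHallRatio K37 num den → num ≤ 2 * den
K37-hallRatio≤2 = Bipartite.hallRatio≤2 K37 leftSide
  (λ u∈ v∈ → <3-independent (∈leftSide⇒<3 u∈) (∈leftSide⇒<3 v∈))
  (λ u∈ v∈ → ≥3-independent (∈∁leftSide⇒≥3 u∈) (∈∁leftSide⇒≥3 v∈))

-- Obstructions

Blocked : ListAssignment 10 → List ℕ → Set
Blocked L cs = ∃ λ w → L (right w) ⊆ cs

proper⇒¬blocked : ∀ {L f} → ProperLColoring K37 L f → ¬ Blocked L (tabulate (f ∘ left))
proper⇒¬blocked {L} {f} (member , proper) (w , covered)
  with i , fw≡fi ← ∈-tabulate⁻ {f = f ∘ left} (covered (member (right w))) =
  proper (left i) (right w) (left-right-adjacent i w) (sym fw≡fi)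

module _ (L : ListAssignment 10) where

  EveryLeftColouring : (ℕ → ℕ → ℕ → Set) → Set
  EveryLeftColouring Q = All (λ x → All (λ y → All (Q x y) (L (left 2F))) (L (left 1F))) (L (left 0F))

  everyLeftColouring? : ∀ {Q} → (∀ x y z → Dec (Q x y z)) → Dec (EveryLeftColouring Q)
  everyLeftColouring? Q? = All.all? (λ x → All.all? (λ y → All.all? (Q? x y) _) _) _

  everyLeftColouring : ∀ {Q} → EveryLeftColouring Q → ∀ (f : Fin 10 → ℕ) → (∀ v → f v ∈ L v) →
                       Q (f (left 0F)) (f (left 1F)) (f (left 2F))
  everyLeftColouring every f member =
    All.lookup (All.lookup (All.lookup every (member (left 0F))) (member (left 1F))) (member (left 2F))

  blocked? : ∀ cs → Dec (Blocked L cs)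
  blocked? cs = anyᶠ? λ w → L (right w) ⊆? cs

  uncolourable : EveryLeftColouring (λ x y z → Blocked L (x ∷ y ∷ z ∷ [])) → ∀ f → ¬ ProperLColoring K37 L f
  uncolourable every f proper = proper⇒¬blocked proper (everyLeftColouring every f (proj₁ proper))

not-flexible-if-uncolourable : ∀ {n} {G : Graph n} {k L} → IsKAssignment k L → Request L →
                               (∀ f → ¬ ProperLColoring G L f) → ∀ p q → ¬ Flexible G k p q
not-flexible-if-uncolourable isK r uncol p q flex with f , proper , _ ← flex _ isK r = uncol f proper

leftRequest : ∀ L (ρ : Vector ℕ 3) → (∀ i → ρ i ∈ L (left i)) → Request L
leftRequest L ρ ρ∈ = record
  { dom = leftSide ; nonempty = 0F , Vec.here ; req = glue ρ (λ _ → 0) ; inList = ρ∈L }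
  where
  ρ∈L : ∀ v → v Subset.∈ leftSide → glue ρ (λ _ → 0) v ∈ L v
  ρ∈L v v∈ with side v
  ... | inLeft i  = subst (_∈ L (left i)) (sym (glue-left ρ _ i)) (ρ∈ i)
  ... | inRight w = contradiction (3≤toℕ-right w) (<⇒≱ (∈leftSide⇒<3 v∈))

isKAssignment? : ∀ {n} k (L : ListAssignment n) → Dec (IsKAssignment k L)
isKAssignment? k L = allᶠ? λ v → (length (L v) ℕ.≟ k) ×-dec unique? (L v)

L₁ : ListAssignment 10
L₁ _ = [ 0 ]

not-flexible₁ : ∀ p q → ¬ Flexible K37 1 p q
not-flexible₁ = not-flexible-if-uncolourable {G = K37} (toWitness {a? = isKAssignment? 1 L₁} _)
  (leftRequest L₁ (λ _ → 0) λ _ → here refl)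
  (uncolourable L₁ (toWitness {a? = everyLeftColouring? L₁ (λ x y z → blocked? L₁ _)} _))

-- On a K₃,₃ all lists are 2-subsets of {1, 2, 3}: the left side uses two colours, and they
-- form a right-hand list.
L₂ : ListAssignment 10
L₂ 0F = 1 ∷ 2 ∷ []
L₂ 1F = 1 ∷ 3 ∷ []
L₂ 2F = 2 ∷ 3 ∷ []
L₂ 3F = 1 ∷ 2 ∷ []
L₂ 4F = 1 ∷ 3 ∷ []
L₂ 5F = 2 ∷ 3 ∷ []
L₂ _  = 1 ∷ 2 ∷ []

not-flexible₂ : ∀ p q → ¬ Flexible K37 2 p q
not-flexible₂ = not-flexible-if-uncolourable {G = K37} (toWitness {a? = isKAssignment? 2 L₂} _)
  (leftRequest L₂ (λ { 0F → 1 ; 1F → 1 ; 2F → 2 }) λ { 0F → here refl ; 1F → here refl ; 2F → here refl })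
  (uncolourable L₂ (toWitness {a? = everyLeftColouring? L₂ (λ x y z → blocked? L₂ _)} _))

-- The right-hand lists are exactly the sets {ρ₃ i, ρ₃ j, x} with i ≢ j and x in the list of
-- the third left vertex, so meeting two of the requests ρ₃ blocks a right vertex.
L₃ : ListAssignment 10
L₃ 0F = 4 ∷ 2 ∷ 0 ∷ []
L₃ 1F = 4 ∷ 5 ∷ 1 ∷ []
L₃ 2F = 4 ∷ 2 ∷ 3 ∷ []
L₃ 3F = 0 ∷ 5 ∷ 2 ∷ []
L₃ 4F = 4 ∷ 3 ∷ 5 ∷ []
L₃ 5F = 0 ∷ 4 ∷ 5 ∷ []
L₃ 6F = 0 ∷ 3 ∷ 1 ∷ []
L₃ 7F = 3 ∷ 5 ∷ 0 ∷ []
L₃ 8F = 0 ∷ 3 ∷ 4 ∷ []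
L₃ 9F = 2 ∷ 5 ∷ 3 ∷ []

ρ₃ : Vector ℕ 3
ρ₃ 0F = 0
ρ₃ 1F = 5
ρ₃ 2F = 3

isK₃ : IsKAssignment 3 L₃
isK₃ = toWitness {a? = isKAssignment? 3 L₃} _

request₃ : Request L₃
request₃ = leftRequest L₃ ρ₃ λ { 0F → there (there (here refl)) ; 1F → there (here refl) ; 2F → there (there (here refl)) }

-- For the colours x, y, z of f on the left side the count below is, by evaluation,
-- ∣ dom request₃ ∩ agree f (req request₃) ∣.
AtMostOneMetOrBlocked : ℕ → ℕ → ℕ → Set
AtMostOneMetOrBlocked x y z =
  ∣ does (x ℕ.≟ ρ₃ 0F) Vec.∷ does (y ℕ.≟ ρ₃ 1F) Vec.∷ does (z ℕ.≟ ρ₃ 2F) Vec.∷ Vec.[] ∣ ≤ 1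
  ⊎ Blocked L₃ (x ∷ y ∷ z ∷ [])

atMostOneMetOrBlocked : EveryLeftColouring L₃ AtMostOneMetOrBlocked
atMostOneMetOrBlocked = toWitness {a? = everyLeftColouring? L₃ (λ x y z → (_ ≤? 1) ⊎-dec blocked? L₃ _)} _

ratio-too-small : ∀ {num den m} → 0 < den → num ≤ 2 * den → den * 3 ≤ num * m → ¬ m ≤ 1
ratio-too-small {num} {den} {m} 0<den num≤2den den*3≤num*m m≤1 =
  <-irrefl refl (*-cancelˡ-≤ den {{>-nonZero 0<den}} (begin
    den * 3   ≤⟨ den*3≤num*m ⟩
    num * m   ≤⟨ *-monoʳ-≤ num m≤1 ⟩
    num * 1   ≡⟨ *-identityʳ num ⟩
    num       ≤⟨ num≤2den ⟩
    2 * den   ≡⟨ *-comm 2 den ⟩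
    den * 2   ∎))
  where open ≤-Reasoning

not-flexible₃ : ∀ {num den} → 0 < den → num ≤ 2 * den → ¬ Flexible K37 3 den num
not-flexible₃ 0<den num≤2den flex with f , proper , den*3≤num*met ← flex L₃ isK₃ request₃ =
  [ ratio-too-small 0<den num≤2den den*3≤num*met , proper⇒¬blocked proper ]′
    (everyLeftColouring L₃ atMostOneMetOrBlocked f (proj₁ proper))

chiFlex>3 : ChiFlexGreaterThan K37 3
chiFlex>3 num den 0<den hall 0 () _
chiFlex>3 num den 0<den hall 1 _ _ = not-flexible₁ den num
chiFlex>3 num den 0<den hall 2 _ _ = not-flexible₂ den num
chiFlex>3 num den 0<den hall 3 _ _ = not-flexible₃ 0<den (K37-hallRatio≤2 {num} {den} hall)
chiFlex>3 num den 0<den hall (suc (suc (suc (suc _)))) _ (s≤s (s≤s (s≤s ())))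

proposition4 : Flexible K37 3 1 10 × ChiFlexGreaterThan K37 3
proposition4 = flexible , chiFlex>3
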